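{- Let $L$ be a finite lattice such that $1\in J(L)$ and $1$ is not an atom of $L$, so that $1\in H(L)$ and the element $w_1$ of $\tilde L$ is defined. Let $\alpha\subseteq\beta\subseteq A(\tilde L)$ with $\beta\setminus\alpha=\{w_1\}$. If $T_\alpha$ satisfies condition (C), then $\overline{T_\alpha}|_L=\overline{T_\beta}|_L$.
   Context: For a lattice $L$ with bottom $0$ and top $1$: an atom is an element covering $0$; $A(L)$ is the set of atoms; $J(L)$ is the set of non-zero join-irreducible elements; $H(L)=J(L)\setminus A(L)$. $\tilde L$ is obtained from the finite lattice $L$ by adding, for each $p\in H(L)$, a new distinct element $w_p$ with $0\prec w_p\prec p$ (so $w_p\le x$ for $x\in L$ iff $p\le x$); $\tilde L$ is a finite atomistic lattice containing $L$ as a sublattice with the same $0,1$, and $A(\tilde L)=A(L)\cup\{w_p\mid p\in H(L)\}$. $A_{\tilde L}(x)=\{a\in A(\tilde L)\mid a\le x\}$; $C(\tilde L)=A(\tilde L)\cup\{0,1\}$ with inherited order. For $\alpha\subseteq A(\tilde L)$, $T_\alpha$ is the t-norm on $C(\tilde L)$ with $T_\alpha(x,y)=x\wedge y$ if $1\in\{x,y\}$, $T_\alpha(x,x)=x$ if $x\in\alpha$, and $T_\alpha(x,y)=0$ otherwise. For a t-norm $T$ on $C(\tilde L)$, $\overline{T}(x,y)=\bigvee_{u\in\kappa(x)}\bigvee_{v\in\kappa(y)}T(u,v)$ on $\tilde L$, where $\kappa(x)=\{u\in C(\tilde L)\setminus\{0\}\mid u\le x\}$; $\overline T|_L$ is its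 restriction to $L\times L$. Condition (C) for $T$: for every $p\in H(L)\setminus\{1\}$, if $T(w_p,w_p)\ne0$ then there is $u\in A_{\tilde L}(p)\setminus\{w_p\}$ with $T(u,u)\ne0$. -}

module Defs where

open import Level using (Level; _⊔_)
open import Data.Product using (Σ; _×_; _,_; ∃)
open import Data.Sum using (_⊎_; inj₁; inj₂)
open import Data.Empty using (⊥)
open import Data.Unit using (⊤)
open import Data.List using (List)
open import Data.List.Relation.Unary.Any using (Any)
open import Relation.Nullary using (¬_; Dec; yes; no)
open import Relation.Unary using (Pred)
open import Relation.Binary using (Rel; Decidable)
open import Relation.Binary.Lattice.Bundles using (BoundedLattice)

module _ {a ℓ₁ ℓ₂ : Level} {A : Set a} (_≈_ : Rel A ℓ₁) (_≤_ : Rel A ℓ₂) where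

  Lt : A → A → Set (ℓ₁ ⊔ ℓ₂)
  Lt x y = x ≤ y × ¬ (x ≈ y)

  Covers : A → A → Set (a ⊔ ℓ₁ ⊔ ℓ₂)
  Covers x y = Lt x y × ¬ (Σ A λ z → Lt x z × Lt z y)

  IsAtom : A → A → Set (a ⊔ ℓ₁ ⊔ ℓ₂)
  IsAtom bot x = Covers bot x

  IsLUB : {ℓ : Level} → Pred A ℓ → A → Set (a ⊔ ℓ ⊔ ℓ₂)
  IsLUB S z = (∀ s → S s → s ≤ z) × (∀ b → (∀ s → S s → s ≤ b) → z ≤ b)

record FiniteLattice (c ℓ₁ ℓ₂ : Level) : Set (Level.suc (c ⊔ ℓ₁ ⊔ ℓ₂)) where
  field
    lat       : BoundedLattice c ℓ₁ ℓ₂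
  open BoundedLattice lat public
  field
    elements  : List Carrier
    complete  : ∀ x → Any (x ≈_) elements
    _≈?_      : Decidable _≈_
    _≤?_      : Decidable _≤_

module Tilde {c ℓ₁ ℓ₂ : Level} (L : FiniteLattice c ℓ₁ ℓ₂) where
  open FiniteLattice L renaming (⊤ to 𝟙; ⊥ to 𝟘)

  Atom : Carrier → Set (c ⊔ ℓ₁ ⊔ ℓ₂)
  Atom = IsAtom _≈_ _≤_ 𝟘

  JoinIrr : Carrier → Set (c ⊔ ℓ₁)
  JoinIrr j = ¬ (j ≈ 𝟘) × (∀ x y → (x ∨ y) ≈ j → x ≈ j ⊎ y ≈ j)

  H : Carrier → Set (c ⊔ ℓ₁ ⊔ ℓ₂)
  H p = JoinIrr p × ¬ Atom p

  -- carrier of L̃ : elements of L, and one new element w_p per p ∈ H(L)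
  C̃ : Set (c ⊔ ℓ₁ ⊔ ℓ₂)
  C̃ = Carrier ⊎ Σ Carrier H

  ι : Carrier → C̃
  ι = inj₁

  w : (p : Carrier) → H p → C̃
  w p hp = inj₂ (p , hp)

  _≈̃_ : C̃ → C̃ → Set ℓ₁
  inj₁ x       ≈̃ inj₁ y       = x ≈ y
  inj₁ x       ≈̃ inj₂ _       = Level.Lift ℓ₁ ⊥
  inj₂ _       ≈̃ inj₁ y       = Level.Lift ℓ₁ ⊥
  inj₂ (p , _) ≈̃ inj₂ (q , _) = p ≈ q

  -- order on L̃ : 0 ≺ w_p ≺ p, and w_p ≤ x (x ∈ L) iff p ≤ x
  _≤̃_ : C̃ → C̃ → Set (ℓ₁ ⊔ ℓ₂)
  inj₁ x       ≤̃ inj₁ y       = Level.Lift ℓ₁ (x ≤ y)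
  inj₁ x       ≤̃ inj₂ _       = Level.Lift ℓ₂ (x ≈ 𝟘)
  inj₂ (p , _) ≤̃ inj₁ y       = Level.Lift ℓ₁ (p ≤ y)
  inj₂ (p , _) ≤̃ inj₂ (q , _) = Level.Lift ℓ₂ (p ≈ q)

  _≈̃?_ : Decidable _≈̃_
  inj₁ x       ≈̃? inj₁ y       = x ≈? y
  inj₁ x       ≈̃? inj₂ _       = no λ ()
  inj₂ _       ≈̃? inj₁ y       = no λ ()
  inj₂ (p , _) ≈̃? inj₂ (q , _) = p ≈? q

  0̃ 1̃ : C̃
  0̃ = ι 𝟘
  1̃ = ι 𝟙

  AtomL̃ : C̃ → Set (c ⊔ ℓ₁ ⊔ ℓ₂)
  AtomL̃ = IsAtom _≈̃_ _≤̃_ 0̃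

  InC : C̃ → Set (c ⊔ ℓ₁ ⊔ ℓ₂)
  InC u = AtomL̃ u ⊎ u ≈̃ 0̃ ⊎ u ≈̃ 1̃

  T : {ℓ : Level} (α : Pred C̃ ℓ) → (∀ u → Dec (α u)) → C̃ → C̃ → C̃
  T α α? x y with x ≈̃? 1̃
  ... | yes _ = y
  ... | no _ with y ≈̃? 1̃
  ...   | yes _ = x
  ...   | no _ with x ≈̃? y | α? x
  ...     | yes _ | yes _ = x
  ...     | _     | _     = 0̃

  κ : C̃ → Pred C̃ (c ⊔ ℓ₁ ⊔ ℓ₂)
  κ x u = InC u × ¬ (u ≈̃ 0̃) × u ≤̃ x

  Vals : {ℓ : Level} (α : Pred C̃ ℓ) → (∀ u → Dec (α u)) → C̃ → C̃ →
         Pred C̃ (c ⊔ ℓ₁ ⊔ ℓ₂)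
  Vals α α? x y z = Σ C̃ λ u → Σ C̃ λ v → κ x u × κ y v × z ≈̃ T α α? u v

  TbarIs : {ℓ : Level} (α : Pred C̃ ℓ) → (∀ u → Dec (α u)) → C̃ → C̃ → C̃ →
           Set (c ⊔ ℓ₁ ⊔ ℓ₂)
  TbarIs α α? x y z = IsLUB _≈̃_ _≤̃_ (Vals α α? x y) z

  AL̃ : C̃ → Pred C̃ (c ⊔ ℓ₁ ⊔ ℓ₂)
  AL̃ x u = AtomL̃ u × u ≤̃ x

  CondC : {ℓ : Level} (α : Pred C̃ ℓ) → (∀ u → Dec (α u)) → Set (c ⊔ ℓ₁ ⊔ ℓ₂)
  CondC α α? =
    ∀ p (hp : H p) → ¬ (p ≈ 𝟙) →
      ¬ (T α α? (w p hp) (w p hp) ≈̃ 0̃) →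
      Σ C̃ λ u → AL̃ (ι p) u × ¬ (u ≈̃ w p hp) × ¬ (T α α? u u ≈̃ 0̃)

{-# OPTIONS --safe #-}
-- T_α and T_β differ only at (w₁, w₁), where T_β gives w₁ and T_α gives 0.
-- For x ∈ L, w₁ ≤ x forces x = 1, so whenever w₁ ∈ κ(x) also 1 ∈ κ(x), and
-- T_α(1, w₁) = w₁ is already a T_α-value; a value 0 never matters for a join.
-- Hence both value sets have the same upper bounds and thus the same join.
-- Condition (C) speaks only about p ≠ 1.
module Submission where

open import Defs
open import Level using (Level; _⊔_; lift)
open import Data.Product using (_×_; _,_; proj₁)
open import Data.Sum using (_⊎_; inj₁; inj₂)
open import Data.Empty using (⊥-elim)
open import Relation.Nullary using (¬_; Dec; yes; no)
open import Relation.Unary using (Pred; _⊆_)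
open import Relation.Binary using (Rel)
open import Relation.Binary.PropositionalEquality using (_≡_; refl; sym; subst)
open import Function.Bundles using (_⇔_; mk⇔; Equivalence)

module _ {a ℓ₁ ℓ₂ : Level} {A : Set a} (_≈_ : Rel A ℓ₁) (_≤_ : Rel A ℓ₂) where

  UpperBound : {ℓ : Level} → Pred A ℓ → A → Set (a ⊔ ℓ ⊔ ℓ₂)
  UpperBound S b = ∀ s → S s → s ≤ b

  IsLUB-cong : {ℓ ℓ′ : Level} {S : Pred A ℓ} {S′ : Pred A ℓ′} →
    (∀ b → UpperBound S b → UpperBound S′ b) →
    (∀ b → UpperBound S′ b → UpperBound S b) →
    ∀ z → IsLUB _≈_ _≤_ S z ⇔ IsLUB _≈_ _≤_ S′ z
  IsLUB-cong S⇒S′ S′⇒S z = mk⇔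
    (λ (ub , least) → S⇒S′ z ub , λ b ub′ → least b (S′⇒S b ub′))
    (λ (ub , least) → S′⇒S z ub , λ b ub′ → least b (S⇒S′ b ub′))

module _ {c ℓ₁ ℓ₂ : Level} (L : FiniteLattice c ℓ₁ ℓ₂) where
  open FiniteLattice L hiding (refl) renaming (⊤ to 𝟙)
  open Tilde L

  ≈̃-trans : ∀ {u v t} → u ≈̃ v → v ≈̃ t → u ≈̃ t
  ≈̃-trans {inj₁ _} {inj₁ _} {inj₁ _} e f = Eq.trans e f
  ≈̃-trans {inj₂ _} {inj₂ _} {inj₂ _} e f = Eq.trans e f

  ≈̃0̃⇒≤̃ : ∀ {z} b → z ≈̃ 0̃ → z ≤̃ b
  ≈̃0̃⇒≤̃ {inj₁ _} (inj₁ b) z≈0 = lift (≤-respˡ-≈ (Eq.sym z≈0) (minimum b))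
  ≈̃0̃⇒≤̃ {inj₁ _} (inj₂ _) z≈0 = lift z≈0

  ≈̃w≤̃ι⇒≤ : ∀ {u p hp x} → u ≈̃ w p hp → u ≤̃ ι x → p ≤ x
  ≈̃w≤̃ι⇒≤ {inj₂ _} u≈w (lift u≤x) = ≤-respˡ-≈ u≈w u≤x

  T-identityˡ : ∀ {ℓ} (α : Pred C̃ ℓ) (α? : ∀ u → Dec (α u)) v → T α α? 1̃ v ≡ v
  T-identityˡ α α? v with 𝟙 ≈? 𝟙
  ... | yes _   = refl
  ... | no 1≉1 = ⊥-elim (1≉1 Eq.refl)

  T-⊆-cases : ∀ {ℓ} {α β : Pred C̃ ℓ} (α? : ∀ u → Dec (α u)) (β? : ∀ u → Dec (β u)) →
    α ⊆ β → ∀ u v →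
    T β β? u v ≡ T α α? u v ⊎
    (u ≈̃ v × β u × ¬ α u × T α α? u v ≡ 0̃ × T β β? u v ≡ u)
  T-⊆-cases α? β? α⊆β u v with u ≈̃? 1̃
  ... | yes _ = inj₁ refl
  ... | no _ with v ≈̃? 1̃
  ...   | yes _ = inj₁ refl
  ...   | no _ with u ≈̃? v
  ...     | no _ = inj₁ refl
  ...     | yes u≈v with α? u | β? u
  ...       | yes αu | yes _  = inj₁ refl
  ...       | yes αu | no ¬βu = ⊥-elim (¬βu (α⊆β αu))
  ...       | no _   | no _   = inj₁ refl
  ...       | no ¬αu | yes βu = inj₂ (u≈v , βu , ¬αu , refl , refl)

  module _ (h1J : JoinIrr 𝟙) (h1A : ¬ Atom 𝟙)
           {ℓ} {α β : Pred C̃ ℓ} (α? : ∀ u → Dec (α u)) (β? : ∀ u → Dec (β u))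
           (α⊆β : α ⊆ β) (new⇒w₁ : ∀ {u} → β u × ¬ α u → u ≈̃ w 𝟙 (h1J , h1A))
           (x y : Carrier) where

    1̃∈κ : ∀ {u} → u ≈̃ w 𝟙 (h1J , h1A) → κ (ι x) u → κ (ι x) 1̃
    1̃∈κ u≈w₁ (_ , _ , u≤x) = inj₂ (inj₂ Eq.refl) , proj₁ h1J , lift (≈̃w≤̃ι⇒≤ u≈w₁ u≤x)

    upperBound-α⇒β : ∀ b → UpperBound _≈̃_ _≤̃_ (Vals α α? (ι x) (ι y)) b →
                            UpperBound _≈̃_ _≤̃_ (Vals β β? (ι x) (ι y)) b
    upperBound-α⇒β b ub z (u , v , u∈κ , v∈κ , z≈Tβ) with T-⊆-cases α? β? α⊆β u v
    ... | inj₁ Tβ≡Tα = ub z (u , v , u∈κ , v∈κ , subst (z ≈̃_) Tβ≡Tα z≈Tβ)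
    ... | inj₂ (u≈v , βu , ¬αu , _ , Tβ≡u) =
      ub z (1̃ , v , 1̃∈κ (new⇒w₁ (βu , ¬αu)) u∈κ , v∈κ , z≈Tα1v)
      where
      z≈Tα1v : z ≈̃ T α α? 1̃ v
      z≈Tα1v = subst (z ≈̃_) (sym (T-identityˡ α α? v))
                     (≈̃-trans {z} (subst (z ≈̃_) Tβ≡u z≈Tβ) u≈v)

    upperBound-β⇒α : ∀ b → UpperBound _≈̃_ _≤̃_ (Vals β β? (ι x) (ι y)) b →
                            UpperBound _≈̃_ _≤̃_ (Vals α α? (ι x) (ι y)) b
    upperBound-β⇒α b ub z (u , v , u∈κ , v∈κ , z≈Tα) with T-⊆-cases α? β? α⊆β u v
    ... | inj₁ Tβ≡Tα = ub z (u , v , u∈κ , v∈κ , subst (z ≈̃_) (sym Tβ≡Tα) z≈Tα)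
    ... | inj₂ (_ , _ , _ , Tα≡0 , _) = ≈̃0̃⇒≤̃ b (subst (z ≈̃_) Tα≡0 z≈Tα)

    Tbar-α⇔β : ∀ z → TbarIs α α? (ι x) (ι y) z ⇔ TbarIs β β? (ι x) (ι y) z
    Tbar-α⇔β = IsLUB-cong _≈̃_ _≤̃_ upperBound-α⇒β upperBound-β⇒α

corollary6p5 : {c ℓ₁ ℓ₂ ℓ : Level} (L : FiniteLattice c ℓ₁ ℓ₂) →
    (h1J : Tilde.JoinIrr L (FiniteLattice.⊤ L)) →
    (h1A : ¬ Tilde.Atom L (FiniteLattice.⊤ L)) →
    (α β : Pred (Tilde.C̃ L) ℓ) →
    (α? : ∀ u → Dec (α u)) → (β? : ∀ u → Dec (β u)) →
    (∀ {u v} → Tilde._≈̃_ L u v → α u → α v) →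
    (∀ {u v} → Tilde._≈̃_ L u v → β u → β v) →
    (∀ u → α u → β u) →
    (∀ u → β u → Tilde.AtomL̃ L u) →
    (∀ u → (β u × ¬ α u) ⇔ Tilde._≈̃_ L u (Tilde.w L (FiniteLattice.⊤ L) (h1J , h1A))) →
    Tilde.CondC L α α? →
    ∀ x y z →
      Tilde.TbarIs L α α? (Tilde.ι L x) (Tilde.ι L y) z ⇔
      Tilde.TbarIs L β β? (Tilde.ι L x) (Tilde.ι L y) z
corollary6p5 L h1J h1A α β α? β? _ _ α⊆β _ β∖α≈w₁ _ x y =
  Tbar-α⇔β L h1J h1A α? β? (α⊆β _) (Equivalence.to (β∖α≈w₁ _)) x y
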